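{- For integers $n\ge m\ge 5$, the grid $P_n\square P_m$ satisfies $c^{0}(P_n\square P_m)=3$, $c^{1}(P_n\square P_m)=5$ and $c^{2}(P_n\square P_m)=8$.
   Context: $P_n$ is the path on $n$ vertices and $\square$ the Cartesian product: $(u,v)\sim(u',v')$ iff ($u=u'$ and $vv'$ is an edge of the second factor) or ($v=v'$ and $uu'$ is an edge of the first factor). For a graph $\Gamma$ and integer $g\ge0$, a set $X\subseteq V(\Gamma)$ is a $g$-good-neighbor cut if $\Gamma-X$ is disconnected and every vertex outside $X$ has at least $g$ neighbors outside $X$. For such $X$ and a component $C$ of $\Gamma-X$, $C$ is splittable if $V(C)$ partitions into nonempty $A,B$ with $\delta(\Gamma[A]),\delta(\Gamma[B])\ge g$; among such partitions with $|A|\ge|B|$ minimizing $|A|-|B|$ set $a(C)=|A|$. $a(X)=\min a(C)$ over splittable components, $c(X)=$ minimum order of a non-splittable component (minima over empty sets $+\infty$), and the gc number is $c^g(\Gamma)=\min_X\{|X|+\min\{a(X),c(X)\}\}$ over all $g$-good-neighbor cuts $X$. -}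

module Defs where

open import Data.Nat using (ℕ; _+_; _*_; _≤_; _∸_)
open import Data.Fin using (Fin; toℕ; remQuot)
open import Data.Fin.Subset using (Subset; _∈_; _∉_; _⊆_; ∁; _∩_; _∪_; ∣_∣; Nonempty; ⊥)
open import Data.Product using (Σ; ∃; _×_; _,_; proj₁; proj₂)
open import Data.Sum using (_⊎_)
open import Relation.Nullary using (¬_)
open import Relation.Binary.PropositionalEquality using (_≡_)

record Graph : Set₁ where
  field
    N   : ℕ
    Adj : Fin N → Fin N → Set
open Graph public

PathAdj : ∀ {n} → Fin n → Fin n → Set
PathAdj i j = (toℕ i + 1 ≡ toℕ j) ⊎ (toℕ j + 1 ≡ toℕ i)

-- The grid P_n □ P_m; vertex k : Fin (n * m) encodes the pair remQuot m k : Fin n × Fin m.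
Grid : ℕ → ℕ → Graph
Grid n m = record { N = n * m ; Adj = adj }
  where
  adj : Fin (n * m) → Fin (n * m) → Set
  adj k l =
    let (u , v) = remQuot {n} m k
        (u' , v') = remQuot {n} m l
    in (u ≡ u' × PathAdj v v') ⊎ (v ≡ v' × PathAdj u u')

module _ (Γ : Graph) where
  private
    V = Fin (N Γ)

  HasNbrs : ℕ → Subset (N Γ) → V → Set
  HasNbrs g S i = ∃ λ T → T ⊆ S × g ≤ ∣ T ∣ × (∀ j → j ∈ T → Adj Γ i j)

  MinDegGE : Subset (N Γ) → ℕ → Set
  MinDegGE S g = ∀ i → i ∈ S → HasNbrs g S i

  data Reach (S : Subset (N Γ)) : V → V → Set where
    here : ∀ {i} → i ∈ S → Reach S i i
    step : ∀ {i k j} → i ∈ S → Adj Γ i k → Reach S k j → Reach S i j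

  Disconnected : Subset (N Γ) → Set
  Disconnected X = ∃ λ u → ∃ λ v → u ∉ X × v ∉ X × ¬ Reach (∁ X) u v

  GoodNeighborCut : ℕ → Subset (N Γ) → Set
  GoodNeighborCut g X = Disconnected X × MinDegGE (∁ X) g

  Component : Subset (N Γ) → Subset (N Γ) → Set
  Component X C =
    C ⊆ ∁ X × Nonempty C
    × (∀ i j → i ∈ C → j ∈ C → Reach C i j)
    × (∀ i j → i ∈ C → j ∉ X → Adj Γ i j → j ∈ C)

  GoodSplit : ℕ → Subset (N Γ) → Subset (N Γ) → Subset (N Γ) → Set
  GoodSplit g C A B =
    A ∪ B ≡ C × A ∩ B ≡ ⊥ × Nonempty A × Nonempty B
    × MinDegGE A g × MinDegGE B g

  Splittable : ℕ → Subset (N Γ) → Set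
  Splittable g C = ∃ λ A → ∃ λ B → GoodSplit g C A B

  AValue : ℕ → Subset (N Γ) → ℕ → Set
  AValue g C t = ∃ λ A → ∃ λ B →
    GoodSplit g C A B × ∣ B ∣ ≤ ∣ A ∣ × ∣ A ∣ ≡ t
    × (∀ A' B' → GoodSplit g C A' B' → ∣ B' ∣ ≤ ∣ A' ∣ → ∣ A ∣ ∸ ∣ B ∣ ≤ ∣ A' ∣ ∸ ∣ B' ∣)

  -- contribution of a component C of Γ - X to min{a(X), c(X)}:
  -- a(C) if C is splittable, |C| otherwise
  CompValue : ℕ → Subset (N Γ) → Subset (N Γ) → ℕ → Set
  CompValue g X C t =
    Component X C × ((Splittable g C × AValue g C t) ⊎ (¬ Splittable g C × ∣ C ∣ ≡ t))

  GCNumberIs : ℕ → ℕ → Set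
  GCNumberIs g k =
    (∃ λ X → GoodNeighborCut g X × ∃ λ C → ∃ λ t → CompValue g X C t × ∣ X ∣ + t ≡ k)
    × (∀ X C t → GoodNeighborCut g X → CompValue g X C t → k ≤ ∣ X ∣ + t)

module Submission where

-- Write k_g = 1, 2, 4 for g = 0, 1, 2.  Removing a set X with |X| ≤ g + 1 ≤ 3 whose complement
-- has minimum degree g leaves the grid (n, m ≥ 4) connected: X misses some row and some column,
-- every vertex whose row or column misses X reaches their crossing, and every vertex reaches such
-- a vertex, since otherwise nearby vertices exhibit rows and columns, all met by X but with no
-- crossing in X, outnumbering X.  Components and the parts of a split inherit minimum degree g,
-- so have at least k_g vertices (the grid is bipartite), whence c^g ≥ (g + 2) + k_g.  The
-- neighbourhood of the 1×1, 1×2 or 2×2 corner at the origin is a g-good-neighbour cut of size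
-- g + 2 whose corner, of size k_g < 2 k_g, cannot be split; so the bound is attained.

open import Defs

open import Data.Bool.Base using (Bool; false; not)
open import Data.Bool.Properties using (not-involutive; not-¬)
open import Data.Empty using (⊥-elim) renaming (⊥ to Empty)
open import Data.Fin using (Fin; toℕ; fromℕ<; combine; remQuot)
open import Data.Fin.Properties
  using (any?; toℕ<n; toℕ-injective; toℕ-fromℕ<; remQuot-combine; combine-remQuot)
  renaming (_≟_ to _≟ᶠ_)
open import Data.Fin.Subset
  using (Subset; _∈_; _∉_; _⊆_; _∪_; _∩_; ∁; ∣_∣; ⊥; ⁅_⁆; _-_; Nonempty; inside; outside)
open import Data.Fin.Subset.Properties
  using (_∈?_; ∉⊥; ∣⊥∣≡0; ∣⁅x⁆∣≡1; x∈⁅x⁆; x∈⁅y⁆⇒x≡y; x∈p∪q⁺; x∈p∪q⁻;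
         p⊆q⇒∣p∣≤∣q∣; p─q⊆p; x∈∁p⇒x∉p; x∉p⇒x∈∁p; x∈p∧x≢y⇒x∈p-y; x∈p⇒∣p-x∣<∣p∣)
open import Data.List using (List; []; _∷_; _++_; length; map; upTo; applyUpTo; cartesianProduct)
open import Data.List.Properties using (length-applyUpTo; length-upTo; length-map; length-++)
import Data.List.Relation.Unary.All.Properties as Allₚ
import Data.List.Relation.Unary.AllPairs.Properties as AllPairsₚ
open import Data.List.Relation.Unary.All as All using (All; []; _∷_)
open import Data.List.Relation.Unary.AllPairs as AllPairs using (AllPairs; []; _∷_)
open import Data.List.Relation.Unary.Any using (here; there)
import Data.List.Relation.Unary.Any as Any
import Data.List.Relation.Unary.Any.Properties as Anyₚ
open import Data.List.Membership.Propositional.Properties using (∈-map⁺; ∈-++⁺ˡ; ∈-++⁺ʳ; ∈-upTo⁺)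
import Data.List.Membership.Propositional as List
import Data.List.Membership.DecPropositional as DecMembership
open import Data.Nat using (ℕ; zero; suc; _+_; _*_; _≤_; _<_; z≤n; s≤s; _<?_; NonZero; >-nonZero⁻¹)
open import Data.Nat.Properties
open import Data.Nat.Induction using (<-wellFounded)
import Induction.WellFounded as WF
import Relation.Binary.Construct.On as On
open import Data.Product using (∃; _×_; _,_; proj₁; proj₂; swap)
open import Data.Product.Properties using (≡-dec)
open import Data.Sum using (_⊎_; inj₁; inj₂; [_,_])
open import Data.Vec using ([]; _∷_; tabulate)
open import Data.Vec.Properties using (lookup∘tabulate; []=⇒lookup; lookup⇒[]=)
open import Function using (_∘_; id)
open import Level using (0ℓ)
open import Relation.Nullary using (¬_; Dec; yes; no; does; ¬?)
open import Relation.Nullary.Decidable using (dec-true; decidable-stable; _×-dec_; _⊎-dec_)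
open import Relation.Unary using (Pred; Decidable)
open import Relation.Binary.PropositionalEquality
  using (_≡_; _≢_; refl; sym; trans; cong; cong₂; subst; subst₂)
open import Relation.Binary.Definitions using (DecidableEquality; Symmetric)

∣p∪q∣+∣p∩q∣≡∣p∣+∣q∣ : ∀ {n} (p q : Subset n) → ∣ p ∪ q ∣ + ∣ p ∩ q ∣ ≡ ∣ p ∣ + ∣ q ∣
∣p∪q∣+∣p∩q∣≡∣p∣+∣q∣ []            []            = refl
∣p∪q∣+∣p∩q∣≡∣p∣+∣q∣ (inside ∷ p)  (inside ∷ q)  =
  cong suc (trans (+-suc _ _) (trans (cong suc (∣p∪q∣+∣p∩q∣≡∣p∣+∣q∣ p q)) (sym (+-suc _ _))))
∣p∪q∣+∣p∩q∣≡∣p∣+∣q∣ (inside ∷ p)  (outside ∷ q) = cong suc (∣p∪q∣+∣p∩q∣≡∣p∣+∣q∣ p q)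
∣p∪q∣+∣p∩q∣≡∣p∣+∣q∣ (outside ∷ p) (inside ∷ q)  =
  trans (cong suc (∣p∪q∣+∣p∩q∣≡∣p∣+∣q∣ p q)) (sym (+-suc _ _))
∣p∪q∣+∣p∩q∣≡∣p∣+∣q∣ (outside ∷ p) (outside ∷ q) = ∣p∪q∣+∣p∩q∣≡∣p∣+∣q∣ p q

∣p∪q∣≤∣p∣+∣q∣ : ∀ {n} (p q : Subset n) → ∣ p ∪ q ∣ ≤ ∣ p ∣ + ∣ q ∣
∣p∪q∣≤∣p∣+∣q∣ p q = ≤-trans (m≤m+n _ _) (≤-reflexive (∣p∪q∣+∣p∩q∣≡∣p∣+∣q∣ p q))

disjoint⇒∣p∪q∣≡∣p∣+∣q∣ : ∀ {n} (p q : Subset n) → p ∩ q ≡ ⊥ → ∣ p ∪ q ∣ ≡ ∣ p ∣ + ∣ q ∣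
disjoint⇒∣p∪q∣≡∣p∣+∣q∣ {n} p q p∩q≡⊥ = begin
  ∣ p ∪ q ∣             ≡⟨ sym (+-identityʳ _) ⟩
  ∣ p ∪ q ∣ + 0         ≡⟨ cong (∣ p ∪ q ∣ +_) (sym (trans (cong ∣_∣ p∩q≡⊥) (∣⊥∣≡0 n))) ⟩
  ∣ p ∪ q ∣ + ∣ p ∩ q ∣ ≡⟨ ∣p∪q∣+∣p∩q∣≡∣p∣+∣q∣ p q ⟩
  ∣ p ∣ + ∣ q ∣         ∎
  where open Relation.Binary.PropositionalEquality.≡-Reasoning

module _ {N : ℕ} where

  select : {P : Pred (Fin N) 0ℓ} → Decidable P → Subset N
  select P? = tabulate (does ∘ P?)

  module _ {P : Pred (Fin N) 0ℓ} (P? : Decidable P) where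

    ∈-select⁺ : ∀ {x} → P x → x ∈ select P?
    ∈-select⁺ {x} px = lookup⇒[]= x _ (trans (lookup∘tabulate (does ∘ P?) x) (dec-true (P? x) px))

    ∈-select⁻ : ∀ {x} → x ∈ select P? → P x
    ∈-select⁻ {x} x∈ with P? x | trans (sym (lookup∘tabulate (does ∘ P?) x)) ([]=⇒lookup x∈)
    ... | yes px | _  = px
    ... | no _   | ()

module _ {N : ℕ} {A : Set} (Meets : Fin N → A → Set) where

  MetBy : Subset N → A → Set
  MetBy X l = ∃ λ x → x ∈ X × Meets x l

  Separated : Subset N → A → A → Set
  Separated X l l′ = ∀ {x} → x ∈ X → Meets x l → Meets x l′ → Empty

  separately-met⇒length≤∣p∣ : ∀ X ls → All (MetBy X) ls → AllPairs (Separated X) ls →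
                              length ls ≤ ∣ X ∣
  separately-met⇒length≤∣p∣ X []       _                         _              = z≤n
  separately-met⇒length≤∣p∣ X (l ∷ ls) ((x , x∈X , x-meets) ∷ met) (seps ∷ pairs) =
    ≤-trans (s≤s (separately-met⇒length≤∣p∣ (X - x) ls met′ pairs′)) (x∈p⇒∣p-x∣<∣p∣ x∈X)
    where
    met′ : All (MetBy (X - x)) ls
    met′ = All.zipWith
      (λ { ((y , y∈X , y-meets) , sep) →
           y , x∈p∧x≢y⇒x∈p-y y∈X (λ { refl → sep x∈X x-meets y-meets }) , y-meets })
      (met , seps)
    pairs′ : AllPairs (Separated (X - x)) ls
    pairs′ = AllPairs.map (λ sep {y} y∈ → sep (p─q⊆p X ⁅ x ⁆ y∈)) pairs

distinct⇒length≤∣p∣ : ∀ {N} {p : Subset N} {xs} → AllPairs _≢_ xs → All (_∈ p) xs → length xs ≤ ∣ p ∣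
distinct⇒length≤∣p∣ {p = p} {xs} distinct xs⊆p = separately-met⇒length≤∣p∣ _≡_ p xs
  (All.map (λ x∈p → _ , x∈p , refl) xs⊆p)
  (AllPairs.map (λ { x≢y {_} _ refl refl → x≢y refl }) distinct)

module _ {N : ℕ} {A : Set} (_≟_ : DecidableEquality A)
         (f : Fin N → A) (f-injective : ∀ {x y} → f x ≡ f y → x ≡ y) where

  ∣p∣≤length-of-cover : ∀ (p : Subset N) ys → (∀ {x} → x ∈ p → f x List.∈ ys) → ∣ p ∣ ≤ length ys
  ∣p∣≤length-of-cover p [] covered =
    ≤-trans (p⊆q⇒∣p∣≤∣q∣ {q = ⊥} (λ x∈p → ⊥-elim (Anyₚ.¬Any[] (covered x∈p)))) (≤-reflexive (∣⊥∣≡0 N))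
  ∣p∣≤length-of-cover p (y ∷ ys) covered
    with any? (λ x → (x ∈? p) ×-dec (f x ≟ y))
  ... | no ¬fibre = ≤-trans (∣p∣≤length-of-cover p ys (λ x∈p → rest x∈p (covered x∈p))) (n≤1+n _)
    where
    rest : ∀ {x} → x ∈ p → f x List.∈ y ∷ ys → f x List.∈ ys
    rest x∈p (here fx≡y) = ⊥-elim (¬fibre (_ , x∈p , fx≡y))
    rest x∈p (there fx∈) = fx∈
  ... | yes (x , x∈p , fx≡y) = begin
    ∣ p ∣                ≤⟨ p⊆q⇒∣p∣≤∣q∣ split ⟩
    ∣ ⁅ x ⁆ ∪ q ∣        ≤⟨ ∣p∪q∣≤∣p∣+∣q∣ ⁅ x ⁆ q ⟩
    ∣ ⁅ x ⁆ ∣ + ∣ q ∣    ≡⟨ cong (_+ ∣ q ∣) (∣⁅x⁆∣≡1 x) ⟩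
    suc ∣ q ∣            ≤⟨ s≤s (∣p∣≤length-of-cover q ys (λ z∈q → rest (∈-select⁻ q? z∈q))) ⟩
    suc (length ys)      ∎
    where
    open ≤-Reasoning
    q? : Decidable (λ z → z ∈ p × f z ≢ y)
    q? z = (z ∈? p) ×-dec ¬? (f z ≟ y)
    q : Subset N
    q = select q?
    split : p ⊆ ⁅ x ⁆ ∪ q
    split {z} z∈p with f z ≟ y
    ... | yes fz≡y = x∈p∪q⁺ (inj₁ (subst (_∈ ⁅ x ⁆) (f-injective (trans fx≡y (sym fz≡y))) (x∈⁅x⁆ x)))
    ... | no  fz≢y = x∈p∪q⁺ (inj₂ (∈-select⁺ q? (z∈p , fz≢y)))
    rest : ∀ {z} → z ∈ p × f z ≢ y → f z List.∈ ys
    rest {z} (z∈p , fz≢y) with covered z∈p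
    ... | here fz≡y = ⊥-elim (fz≢y fz≡y)
    ... | there fz∈ = fz∈

length<∣p∣⇒∃∉ : ∀ {N} (p : Subset N) ys → length ys < ∣ p ∣ → ∃ λ x → x ∈ p × ¬ (x List.∈ ys)
length<∣p∣⇒∃∉ p ys ys<p with any? (λ x → (x ∈? p) ×-dec ¬? (DecMembership._∈?_ _≟ᶠ_ x ys))
... | yes found = found
... | no ¬found = ⊥-elim (<⇒≱ ys<p (∣p∣≤length-of-cover _≟ᶠ_ id id p ys covered))
  where
  covered : ∀ {x} → x ∈ p → x List.∈ ys
  covered {x} x∈p = decidable-stable (DecMembership._∈?_ _≟ᶠ_ x ys) (λ x∉ys → ¬found (x , x∈p , x∉ys))

length-cartesianProduct : ∀ {A B : Set} (xs : List A) (ys : List B) →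
                          length (cartesianProduct xs ys) ≡ length xs * length ys
length-cartesianProduct []       ys = refl
length-cartesianProduct (x ∷ xs) ys = begin
  length (map (x ,_) ys ++ cartesianProduct xs ys)          ≡⟨ length-++ (map (x ,_) ys) ⟩
  length (map (x ,_) ys) + length (cartesianProduct xs ys)  ≡⟨ cong₂ _+_ (length-map (x ,_) ys)
                                                                         (length-cartesianProduct xs ys) ⟩
  length ys + length xs * length ys                         ∎
  where open Relation.Binary.PropositionalEquality.≡-Reasoning

∈-cartesianProduct⁺ : ∀ {A B : Set} {x : A} {y : B} {xs ys} → x List.∈ xs → y List.∈ ys →
                      (x , y) List.∈ cartesianProduct xs ys
∈-cartesianProduct⁺ x∈xs y∈ys = Any.map (λ { (refl , refl) → refl }) (Anyₚ.cartesianProduct⁺ x∈xs y∈ys)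

-- Good-neighbour cuts in an arbitrary graph

module GraphTheory (Γ : Graph) where

  private
    _~_ : Fin (N Γ) → Fin (N Γ) → Set
    _~_ = Adj Γ

  Connected : Subset (N Γ) → Set
  Connected S = ∀ {u v} → u ∈ S → v ∈ S → Reach Γ S u v

  module _ {S : Subset (N Γ)} where

    reach-source : ∀ {i j} → Reach Γ S i j → i ∈ S
    reach-source (here i∈S)     = i∈S
    reach-source (step i∈S _ _) = i∈S

    reach-target : ∀ {i j} → Reach Γ S i j → j ∈ S
    reach-target (here j∈S)   = j∈S
    reach-target (step _ _ r) = reach-target r

    reach-trans : ∀ {i j k} → Reach Γ S i j → Reach Γ S j k → Reach Γ S i k
    reach-trans (here _)         r′ = r′
    reach-trans (step i∈S i~ r) r′ = step i∈S i~ (reach-trans r r′)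

    reach-snoc : ∀ {i j k} → Reach Γ S i j → j ~ k → k ∈ S → Reach Γ S i k
    reach-snoc r j~k k∈S = reach-trans r (step (reach-target r) j~k (here k∈S))

    reach-edge : ∀ {i j} → i ∈ S → j ∈ S → i ~ j → Reach Γ S i j
    reach-edge i∈S j∈S i~j = step i∈S i~j (here j∈S)

    reach-sym : Symmetric _~_ → ∀ {i j} → Reach Γ S i j → Reach Γ S j i
    reach-sym ~-sym (here i∈S)        = here i∈S
    reach-sym ~-sym (step i∈S i~k r) = reach-snoc (reach-sym ~-sym r) (~-sym i~k) i∈S

    hasNbrs₀ : ∀ {i} → HasNbrs Γ 0 S i
    hasNbrs₀ = ⊥ , (λ x∈⊥ → ⊥-elim (∉⊥ x∈⊥)) , z≤n , (λ _ x∈⊥ → ⊥-elim (∉⊥ x∈⊥))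

    hasNbrs₁ : ∀ {i j} → j ∈ S → i ~ j → HasNbrs Γ 1 S i
    hasNbrs₁ {i} {j} j∈S i~j =
      ⁅ j ⁆ , (λ x∈ → subst (_∈ S) (sym (x∈⁅y⁆⇒x≡y j x∈)) j∈S) ,
      ≤-reflexive (sym (∣⁅x⁆∣≡1 j)) , (λ x x∈ → subst (i ~_) (sym (x∈⁅y⁆⇒x≡y j x∈)) i~j)

    hasNbrs₂ : ∀ {i j j′} → j ∈ S → j′ ∈ S → j ≢ j′ → i ~ j → i ~ j′ → HasNbrs Γ 2 S i
    hasNbrs₂ {i} {j} {j′} j∈S j′∈S j≢j′ i~j i~j′ = T , T⊆S , ∣T∣≥2 , i~T
      where
      T : Subset (N Γ)
      T = ⁅ j ⁆ ∪ ⁅ j′ ⁆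
      cases : ∀ {x} → x ∈ T → x ≡ j ⊎ x ≡ j′
      cases {x} x∈ with x∈p∪q⁻ ⁅ j ⁆ ⁅ j′ ⁆ x∈
      ... | inj₁ x∈j  = inj₁ (x∈⁅y⁆⇒x≡y j x∈j)
      ... | inj₂ x∈j′ = inj₂ (x∈⁅y⁆⇒x≡y j′ x∈j′)
      T⊆S : T ⊆ S
      T⊆S x∈ with cases x∈
      ... | inj₁ refl = j∈S
      ... | inj₂ refl = j′∈S
      ∣T∣≥2 : 2 ≤ ∣ T ∣
      ∣T∣≥2 = distinct⇒length≤∣p∣ ((j≢j′ ∷ []) ∷ [] ∷ [])
                (x∈p∪q⁺ (inj₁ (x∈⁅x⁆ j)) ∷ x∈p∪q⁺ (inj₂ (x∈⁅x⁆ j′)) ∷ [])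
      i~T : ∀ x → x ∈ T → i ~ x
      i~T x x∈ with cases x∈
      ... | inj₁ refl = i~j
      ... | inj₂ refl = i~j′

    some-neighbour : ∀ {g i} → HasNbrs Γ (suc g) S i → ∃ λ j → j ∈ S × i ~ j
    some-neighbour {g} (T , T⊆S , g<∣T∣ , i~T) with length<∣p∣⇒∃∉ T [] (≤-trans (s≤s z≤n) g<∣T∣)
    ... | j , j∈T , _ = j , T⊆S j∈T , i~T j j∈T

    neighbour-other-than : ∀ {g i} → HasNbrs Γ (suc (suc g)) S i → ∀ u → ∃ λ j → j ∈ S × i ~ j × j ≢ u
    neighbour-other-than (T , T⊆S , g<∣T∣ , i~T) u
      with length<∣p∣⇒∃∉ T (u ∷ []) (≤-trans (s≤s (s≤s z≤n)) g<∣T∣)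
    ... | j , j∈T , j∉[u] = j , T⊆S j∈T , i~T j j∈T , (λ j≡u → j∉[u] (here j≡u))

  closed-reach : ∀ {X C} → (∀ i j → i ∈ C → j ∉ X → i ~ j → j ∈ C) →
                 ∀ {i j} → Reach Γ (∁ X) i j → i ∈ C → j ∈ C
  closed-reach closed (here _)         i∈C = i∈C
  closed-reach closed (step _ i~k k⇝j) i∈C =
    closed-reach closed k⇝j (closed _ _ i∈C (x∈∁p⇒x∉p (reach-source k⇝j)) i~k)

  MinOrder : ℕ → ℕ → Set
  MinOrder g k = ∀ {A} → Nonempty A → MinDegGE Γ A g → k ≤ ∣ A ∣

  minOrder₀ : MinOrder 0 1
  minOrder₀ (i , i∈A) _ = distinct⇒length≤∣p∣ ([] ∷ []) (i∈A ∷ [])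

  module _ (~⇒≢ : ∀ {i j} → i ~ j → i ≢ j) where

    minOrder₁ : MinOrder 1 2
    minOrder₁ (i , i∈A) δ with some-neighbour (δ i i∈A)
    ... | j , j∈A , i~j = distinct⇒length≤∣p∣ ((~⇒≢ i~j ∷ []) ∷ [] ∷ []) (i∈A ∷ j∈A ∷ [])

    minOrder₂ : (∀ {i j k} → i ~ j → j ~ k → ¬ i ~ k) → MinOrder 2 4
    minOrder₂ triangle-free (i , i∈A) δ
      with some-neighbour (δ i i∈A)
    ... | j , j∈A , i~j
      with neighbour-other-than (δ i i∈A) j | neighbour-other-than (δ j j∈A) i
    ... | j′ , j′∈A , i~j′ , j′≢j | k , k∈A , j~k , k≢i =
      distinct⇒length≤∣p∣
        ((~⇒≢ i~j ∷ ~⇒≢ i~j′ ∷ k≢i ∘ sym ∷ []) ∷ (j′≢j ∘ sym ∷ ~⇒≢ j~k ∷ []) ∷ (j′≢k ∷ []) ∷ [] ∷ [])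
        (i∈A ∷ j∈A ∷ j′∈A ∷ k∈A ∷ [])
      where
      j′≢k : j′ ≢ k
      j′≢k refl = triangle-free i~j j~k i~j′

  component-minDeg : ∀ {X C g} → MinDegGE Γ (∁ X) g → Component Γ X C → MinDegGE Γ C g
  component-minDeg δ (C⊆∁X , _ , _ , closed) i i∈C with δ i (C⊆∁X i∈C)
  ... | T , T⊆∁X , g≤∣T∣ , i~T =
    T , (λ {j} j∈T → closed i j i∈C (x∈∁p⇒x∉p (T⊆∁X j∈T)) (i~T j j∈T)) , g≤∣T∣ , i~T

  compValue-≥ : ∀ {X C g k t} → MinOrder g k → MinDegGE Γ (∁ X) g → CompValue Γ g X C t → k ≤ t
  compValue-≥ {k = k} order δ (_ , inj₁ (_ , (_ , _ , (_ , _ , nonempty , _ , δA , _) , _ , ∣A∣≡t , _))) =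
    subst (k ≤_) ∣A∣≡t (order nonempty δA)
  compValue-≥ {k = k} order δ (component , inj₂ (_ , ∣C∣≡t)) =
    subst (k ≤_) ∣C∣≡t (order (proj₁ (proj₂ component)) (component-minDeg δ component))

  small⇒¬splittable : ∀ {C g k} → MinOrder g k → ∣ C ∣ < k + k → ¬ Splittable Γ g C
  small⇒¬splittable {C} {k = k} order ∣C∣<2k (A , B , A∪B≡C , A∩B≡⊥ , neA , neB , δA , δB) =
    <⇒≱ ∣C∣<2k (begin
      k + k         ≤⟨ +-mono-≤ (order neA δA) (order neB δB) ⟩
      ∣ A ∣ + ∣ B ∣ ≡⟨ sym (disjoint⇒∣p∪q∣≡∣p∣+∣q∣ A B A∩B≡⊥) ⟩
      ∣ A ∪ B ∣     ≡⟨ cong ∣_∣ A∪B≡C ⟩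
      ∣ C ∣         ∎)
    where open ≤-Reasoning

  disconnected⇒∣X∣> : ∀ {X j} → (∣ X ∣ ≤ j → Connected (∁ X)) → Disconnected Γ X → j < ∣ X ∣
  disconnected⇒∣X∣> {X} {j} connected (u , v , u∉X , v∉X , ¬u⇝v) with j <? ∣ X ∣
  ... | yes j<∣X∣ = j<∣X∣
  ... | no  j≮∣X∣ = ⊥-elim (¬u⇝v (connected (≮⇒≥ j≮∣X∣) (x∉p⇒x∈∁p u∉X) (x∉p⇒x∈∁p v∉X)))

  gcNumber-≥ : ∀ {g j k} → (∀ {X} → ∣ X ∣ ≤ j → MinDegGE Γ (∁ X) g → Connected (∁ X)) → MinOrder g k →
               ∀ X C t → GoodNeighborCut Γ g X → CompValue Γ g X C t → suc j + k ≤ ∣ X ∣ + t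
  gcNumber-≥ connected order X C t (disconnected , δ) value =
    +-mono-≤ (disconnected⇒∣X∣> (λ ∣X∣≤j → connected ∣X∣≤j δ) disconnected) (compValue-≥ order δ value)

  gcNumberIs-attained : ∀ {g k X C} →
    (∀ X C t → GoodNeighborCut Γ g X → CompValue Γ g X C t → k ≤ ∣ X ∣ + t) →
    GoodNeighborCut Γ g X → Component Γ X C → ¬ Splittable Γ g C → ∣ X ∣ + ∣ C ∣ ≤ k → GCNumberIs Γ g k
  gcNumberIs-attained {g} {X = X} {C} lower cut component ¬splittable upper =
    (X , cut , C , ∣ C ∣ , value , ≤-antisym upper (lower X C ∣ C ∣ cut value)) , lower
    where
    value : CompValue Γ g X C ∣ C ∣
    value = component , inj₂ (¬splittable , refl)

data Step (x y : ℕ) : Set where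
  forth : suc x ≡ y → Step x y
  back  : suc y ≡ x → Step x y

step-sym : ∀ {x y} → Step x y → Step y x
step-sym (forth e) = back e
step-sym (back e)  = forth e

step⇒≢ : ∀ {x y} → Step x y → x ≢ y
step⇒≢ (forth refl) x≡y = 1+n≢n (sym x≡y)
step⇒≢ (back refl)  x≡y = 1+n≢n x≡y

step-+ˡ : ∀ a {x y} → Step x y → Step (a + x) (a + y)
step-+ˡ a (forth refl) = forth (sym (+-suc a _))
step-+ˡ a (back refl)  = back (sym (+-suc a _))

step-+ʳ : ∀ b {x y} → Step x y → Step (x + b) (y + b)
step-+ʳ b (forth refl) = forth refl
step-+ʳ b (back refl)  = back refl

parity : ℕ → Bool
parity zero    = false
parity (suc x) = not (parity x)

parity-step : ∀ {x y} → Step x y → parity y ≡ not (parity x)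
parity-step (forth refl) = refl
parity-step (back refl)  = sym (not-involutive _)

step-within : ∀ {r a} → 2 ≤ r → a < r → ∃ λ a′ → a′ < r × Step a a′
step-within {a = zero}  2≤r _     = 1 , 2≤r , forth refl
step-within {a = suc a} _   a+1<r = a , <-trans (n<1+n a) a+1<r , back refl

step-away : ∀ {r n a} → 3 + r ≤ n → a < n → ∃ λ a′ → a′ < n × Step a a′ × (a′ ≡ suc a ⊎ r < a′)
step-away {a = zero} 3+r≤n _ = 1 , ≤-trans (s≤s (s≤s z≤n)) 3+r≤n , forth refl , inj₁ refl
step-away {r} {n} {suc a} 3+r≤n a+1<n with suc (suc a) <? n
... | yes a+2<n = suc (suc a) , a+2<n , forth refl , inj₁ refl
... | no  a+2≮n = a , <-trans (n<1+n a) a+1<n , back refl ,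
                  inj₂ (≤-pred (≤-pred (≤-trans 3+r≤n (≮⇒≥ a+2≮n))))

-- The frame of the r × s corner at the origin is its neighbourhood: row r below it and
-- column s to its right.
InCorner InFrame : ℕ → ℕ → ℕ → ℕ → Set
InCorner r s a b = a < r × b < s
InFrame  r s a b = (a ≡ r × b < s) ⊎ (a < r × b ≡ s)

inCorner? : ∀ r s a b → Dec (InCorner r s a b)
inCorner? r s a b = (a <? r) ×-dec (b <? s)

inFrame? : ∀ r s a b → Dec (InFrame r s a b)
inFrame? r s a b = ((a ≟ r) ×-dec (b <? s)) ⊎-dec ((a <? r) ×-dec (b ≟ s))

frame-transpose : ∀ {r s a b} → InFrame r s a b → InFrame s r b a
frame-transpose (inj₁ (a≡r , b<s)) = inj₂ (b<s , a≡r)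
frame-transpose (inj₂ (a<r , b≡s)) = inj₁ (b≡s , a<r)

inCorner⇒¬inFrame : ∀ {r s a b} → InCorner r s a b → ¬ InFrame r s a b
inCorner⇒¬inFrame (a<r , _)   (inj₁ (a≡r , _)) = <⇒≢ a<r a≡r
inCorner⇒¬inFrame (_   , b<s) (inj₂ (_ , b≡s)) = <⇒≢ b<s b≡s

corner-closed : ∀ {r s a b a′} → InCorner r s a b → Step a a′ → ¬ InFrame r s a′ b → InCorner r s a′ b
corner-closed (a<r , b<s) (back a′+1≡a) _ = <-trans (≤-reflexive a′+1≡a) a<r , b<s
corner-closed (a<r , b<s) (forth refl) ¬frame with m≤n⇒m<n∨m≡n a<r
... | inj₁ a+1<r = a+1<r , b<s
... | inj₂ a+1≡r = ⊥-elim (¬frame (inj₁ (a+1≡r , b<s)))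

frame-avoiding-step : ∀ {r s n a b} → 2 ≤ r → 3 + r ≤ n → a < n → ¬ InFrame r s a b →
                      ∃ λ a′ → a′ < n × Step a a′ × ¬ InFrame r s a′ b
frame-avoiding-step {r} {s} {n} {a} {b} 2≤r 3+r≤n a<n ¬frame with inCorner? r s a b
... | yes (a<r , b<s) = within-corner (step-within 2≤r a<r)
  where
  within-corner : (∃ λ a′ → a′ < r × Step a a′) → ∃ λ a′ → a′ < n × Step a a′ × ¬ InFrame r s a′ b
  within-corner (a′ , a′<r , a~a′) =
    a′ , <-trans a′<r (≤-trans (m≤n+m (suc r) 2) 3+r≤n) , a~a′ , inCorner⇒¬inFrame (a′<r , b<s)
... | no ¬corner = beyond-corner (step-away 3+r≤n a<n)
  where
  beyond-corner : (∃ λ a′ → a′ < n × Step a a′ × (a′ ≡ suc a ⊎ r < a′)) →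
                  ∃ λ a′ → a′ < n × Step a a′ × ¬ InFrame r s a′ b
  beyond-corner (a′ , a′<n , a~a′ , inj₁ refl) =
    a′ , a′<n , a~a′ , [ (λ { (a+1≡r , b<s) → ¬corner (≤-reflexive a+1≡r , b<s) })
                       , (λ { (a+1<r , b≡s) → ¬frame (inj₂ (<-trans (n<1+n a) a+1<r , b≡s)) }) ]
  beyond-corner (a′ , a′<n , a~a′ , inj₂ r<a′) =
    a′ , a′<n , a~a′ , [ (λ { (a′≡r , _) → <⇒≢ r<a′ (sym a′≡r) })
                       , (λ { (a′<r , _) → <-asym r<a′ a′<r }) ]

module GridGraph (n m : ℕ) where

  open GraphTheory (Grid n m) public

  V : Set
  V = Fin (n * m)

  _~_ : V → V → Set
  _~_ = Adj (Grid n m)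

  row col : V → ℕ
  row k = toℕ (proj₁ (remQuot {n} m k))
  col k = toℕ (proj₂ (remQuot {n} m k))

  row<n : ∀ k → row k < n
  row<n k = toℕ<n (proj₁ (remQuot {n} m k))

  col<m : ∀ k → col k < m
  col<m k = toℕ<n (proj₂ (remQuot {n} m k))

  vertex : ∀ {a b} → a < n → b < m → V
  vertex a<n b<m = combine (fromℕ< a<n) (fromℕ< b<m)

  row-vertex : ∀ {a b} (a<n : a < n) (b<m : b < m) → row (vertex a<n b<m) ≡ a
  row-vertex a<n b<m =
    trans (cong (toℕ ∘ proj₁) (remQuot-combine (fromℕ< a<n) (fromℕ< b<m))) (toℕ-fromℕ< a<n)

  col-vertex : ∀ {a b} (a<n : a < n) (b<m : b < m) → col (vertex a<n b<m) ≡ b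
  col-vertex a<n b<m =
    trans (cong (toℕ ∘ proj₂) (remQuot-combine {n} (fromℕ< a<n) (fromℕ< b<m))) (toℕ-fromℕ< b<m)

  coords-injective : ∀ {k l} → row k ≡ row l → col k ≡ col l → k ≡ l
  coords-injective {k} {l} row≡ col≡ =
    trans (sym (combine-remQuot {n} m k))
      (trans (cong₂ combine (toℕ-injective row≡) (toℕ-injective col≡)) (combine-remQuot {n} m l))

  data Neighbour (k l : V) : Set where
    horizontal : row l ≡ row k → Step (col k) (col l) → Neighbour k l
    vertical   : col l ≡ col k → Step (row k) (row l) → Neighbour k l

  ~⇒neighbour : ∀ {k l} → k ~ l → Neighbour k l
  ~⇒neighbour (inj₁ (e , inj₁ s)) = horizontal (cong toℕ (sym e)) (forth (trans (+-comm 1 _) s))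
  ~⇒neighbour (inj₁ (e , inj₂ s)) = horizontal (cong toℕ (sym e)) (back (trans (+-comm 1 _) s))
  ~⇒neighbour (inj₂ (e , inj₁ s)) = vertical (cong toℕ (sym e)) (forth (trans (+-comm 1 _) s))
  ~⇒neighbour (inj₂ (e , inj₂ s)) = vertical (cong toℕ (sym e)) (back (trans (+-comm 1 _) s))

  neighbour⇒~ : ∀ {k l} → Neighbour k l → k ~ l
  neighbour⇒~ (horizontal e (forth s)) = inj₁ (toℕ-injective (sym e) , inj₁ (trans (+-comm _ 1) s))
  neighbour⇒~ (horizontal e (back s))  = inj₁ (toℕ-injective (sym e) , inj₂ (trans (+-comm _ 1) s))
  neighbour⇒~ (vertical e (forth s))   = inj₂ (toℕ-injective (sym e) , inj₁ (trans (+-comm _ 1) s))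
  neighbour⇒~ (vertical e (back s))    = inj₂ (toℕ-injective (sym e) , inj₂ (trans (+-comm _ 1) s))

  ~-sym : Symmetric _~_
  ~-sym k~l with ~⇒neighbour k~l
  ... | horizontal e s = neighbour⇒~ (horizontal (sym e) (step-sym s))
  ... | vertical e s   = neighbour⇒~ (vertical (sym e) (step-sym s))

  colour : V → Bool
  colour k = parity (row k + col k)

  colour-~ : ∀ {k l} → k ~ l → colour l ≡ not (colour k)
  colour-~ {k} {l} k~l with ~⇒neighbour k~l
  ... | horizontal e s rewrite e = parity-step (step-+ˡ (row k) s)
  ... | vertical e s   rewrite e = parity-step (step-+ʳ (col k) s)

  ~⇒≢ : ∀ {k l} → k ~ l → k ≢ l
  ~⇒≢ k~l refl = not-¬ refl (colour-~ k~l)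

  triangle-free : ∀ {i j k} → i ~ j → j ~ k → ¬ i ~ k
  triangle-free i~j j~k i~k =
    not-¬ (trans (colour-~ i~k) (sym (colour-~ i~j))) (colour-~ j~k)

  -- Rows and columns at once: `fixed` is constant along the line, `moving` is the position on it.
  module Walk {fixed moving : V → ℕ}
              (coords-injective′ : ∀ {k l} → fixed k ≡ fixed l → moving k ≡ moving l → k ≡ l)
              (predecessor : ∀ k {c} → moving k ≡ suc c →
                             ∃ λ k′ → fixed k′ ≡ fixed k × moving k′ ≡ c × k′ ~ k)
              {S : Subset (n * m)} where

    Segment : V → Set
    Segment k = ∀ x → fixed x ≡ fixed k → moving x ≤ moving k → x ∈ S

    walk : ∀ d {k l} → fixed l ≡ fixed k → moving l + d ≡ moving k → Segment k → Reach (Grid n m) S l k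
    walk zero {k} fl≡fk ml+0≡mk segment =
      subst (λ z → Reach (Grid n m) S z k)
            (sym (coords-injective′ fl≡fk (trans (sym (+-identityʳ _)) ml+0≡mk)))
            (here (segment k refl ≤-refl))
    walk (suc d) {k} {l} fl≡fk ml+d+1≡mk segment
      with predecessor k (trans (sym ml+d+1≡mk) (+-suc _ d))
    ... | k′ , fk′≡fk , mk′≡ml+d , k′~k =
      reach-snoc (walk d (trans fl≡fk (sym fk′≡fk)) (sym mk′≡ml+d) segment′) k′~k (segment k refl ≤-refl)
      where
      mk′≤mk : moving k′ ≤ moving k
      mk′≤mk = ≤-trans (≤-reflexive mk′≡ml+d)
                 (≤-trans (n≤1+n _) (≤-reflexive (trans (sym (+-suc _ d)) ml+d+1≡mk)))
      segment′ : Segment k′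
      segment′ x fx≡fk′ mx≤mk′ = segment x (trans fx≡fk′ fk′≡fk) (≤-trans mx≤mk′ mk′≤mk)

    reach-along : ∀ {k l} → Segment k → fixed l ≡ fixed k → moving l ≤ moving k → Reach (Grid n m) S l k
    reach-along segment fl≡fk ml≤mk = walk _ fl≡fk (m+[n∸m]≡n ml≤mk) segment

  left-neighbour : ∀ k {c} → col k ≡ suc c → ∃ λ k′ → row k′ ≡ row k × col k′ ≡ c × k′ ~ k
  left-neighbour k {c} col≡ =
    k′ , row-k′ , col-k′ , neighbour⇒~ (horizontal (sym row-k′) (forth (trans (cong suc col-k′) (sym col≡))))
    where
    c<m : c < m
    c<m = <-trans (subst (c <_) (sym col≡) (n<1+n c)) (col<m k)
    k′ : V
    k′ = vertex (row<n k) c<m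
    row-k′ : row k′ ≡ row k
    row-k′ = row-vertex (row<n k) c<m
    col-k′ : col k′ ≡ c
    col-k′ = col-vertex (row<n k) c<m

  upper-neighbour : ∀ k {c} → row k ≡ suc c → ∃ λ k′ → col k′ ≡ col k × row k′ ≡ c × k′ ~ k
  upper-neighbour k {c} row≡ =
    k′ , col-k′ , row-k′ , neighbour⇒~ (vertical (sym col-k′) (forth (trans (cong suc row-k′) (sym row≡))))
    where
    c<n : c < n
    c<n = <-trans (subst (c <_) (sym row≡) (n<1+n c)) (row<n k)
    k′ : V
    k′ = vertex c<n (col<m k)
    row-k′ : row k′ ≡ c
    row-k′ = row-vertex c<n (col<m k)
    col-k′ : col k′ ≡ col k
    col-k′ = col-vertex c<n (col<m k)

  module RowWalk {S} = Walk coords-injective left-neighbour {S}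
  module ColWalk {S} = Walk (λ col≡ row≡ → coords-injective row≡ col≡) upper-neighbour {S}

  index : V → ℕ
  index k = row k * m + col k

  index-above : ∀ {k l} → row l < row k → index l < index k
  index-above {k} {l} row<row = begin-strict
    row l * m + col l <⟨ +-monoʳ-< (row l * m) (col<m l) ⟩
    row l * m + m     ≡⟨ +-comm (row l * m) m ⟩
    suc (row l) * m   ≤⟨ *-monoˡ-≤ m row<row ⟩
    row k * m         ≤⟨ m≤m+n (row k * m) (col k) ⟩
    index k           ∎
    where open ≤-Reasoning

  index-left : ∀ {k l} → row l ≡ row k → col l < col k → index l < index k
  index-left {k} row≡ col<col rewrite row≡ = +-monoʳ-< (row k * m) col<col

  -- Cuts of at most three vertices

  data Line : Set where
    rowLine colLine : ℕ → Line

  OnLine : V → Line → Set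
  OnLine x (rowLine r) = row x ≡ r
  OnLine x (colLine c) = col x ≡ c

  onLine? : ∀ x ℓ → Dec (OnLine x ℓ)
  onLine? x (rowLine r) = row x ≟ r
  onLine? x (colLine c) = col x ≟ c

  module SmallCut (X : Subset (n * m)) where

    Hit : Line → Set
    Hit = MetBy OnLine X

    hit? : ∀ ℓ → Dec (Hit ℓ)
    hit? ℓ = any? (λ x → (x ∈? X) ×-dec onLine? x ℓ)

    Separate : Line → Line → Set
    Separate = Separated OnLine X

    lines-bound : ∀ ℓs → All Hit ℓs → AllPairs Separate ℓs → length ℓs ≤ ∣ X ∣
    lines-bound = separately-met⇒length≤∣p∣ OnLine X

    rows-separate : ∀ {r r′} → r ≢ r′ → Separate (rowLine r) (rowLine r′)
    rows-separate r≢r′ _ refl refl = r≢r′ refl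

    cols-separate : ∀ {c c′} → c ≢ c′ → Separate (colLine c) (colLine c′)
    cols-separate c≢c′ _ refl refl = c≢c′ refl

    crossing-separate : ∀ {k r c} → k ∉ X → row k ≡ r → col k ≡ c → Separate (rowLine r) (colLine c)
    crossing-separate k∉X refl refl x∈X row≡ col≡ = k∉X (subst (_∈ X) (coords-injective row≡ col≡) x∈X)

    free-line : (line : ℕ → Line) → (∀ {a b} → a ≢ b → Separate (line a) (line b)) →
                ∀ k → ∣ X ∣ < k → ∃ λ a → a < k × ¬ Hit (line a)
    free-line line separate k ∣X∣<k with anyUpTo? (λ a → ¬? (hit? (line a))) k
    ... | yes free = free
    ... | no ¬free = ⊥-elim (<⇒≱ ∣X∣<k (subst (_≤ ∣ X ∣) (length-applyUpTo line k)
            (lines-bound (applyUpTo line k) (Allₚ.applyUpTo⁺₁ line k hit)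
                         (AllPairsₚ.applyUpTo⁺₁ line k (λ a<b _ → separate (<⇒≢ a<b))))))
      where
      hit : ∀ {a} → a < k → Hit (line a)
      hit {a} a<k = decidable-stable (hit? (line a)) (λ ¬hit → ¬free (a , a<k , ¬hit))

    Good Bad : V → Set
    Good k = ¬ Hit (rowLine (row k)) ⊎ ¬ Hit (colLine (col k))
    Bad k = Hit (rowLine (row k)) × Hit (colLine (col k))

    good? : ∀ k → Good k ⊎ Bad k
    good? k with hit? (rowLine (row k)) | hit? (colLine (col k))
    ... | no ¬hit | _       = inj₁ (inj₁ ¬hit)
    ... | yes _   | no ¬hit = inj₁ (inj₂ ¬hit)
    ... | yes hr  | yes hc  = inj₂ (hr , hc)

    ReachesGood : V → Set
    ReachesGood u = ∃ λ w → Good w × Reach (Grid n m) (∁ X) u w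

    off-free-line : ∀ {ℓ x} → ¬ Hit ℓ → OnLine x ℓ → x ∈ ∁ X
    off-free-line free x-on-ℓ = x∉p⇒x∈∁p (λ x∈X → free (_ , x∈X , x-on-ℓ))

    along-free-row : ∀ {r k l} → ¬ Hit (rowLine r) → row k ≡ r → row l ≡ r → Reach (Grid n m) (∁ X) k l
    along-free-row {k = k} {l} free row-k row-l with ≤-total (col k) (col l)
    ... | inj₁ col≤col =
      RowWalk.reach-along (λ _ row-x _ → off-free-line {rowLine _} free (trans row-x row-l))
                          (trans row-k (sym row-l)) col≤col
    ... | inj₂ col≥col = reach-sym ~-sym
      (RowWalk.reach-along (λ _ row-x _ → off-free-line {rowLine _} free (trans row-x row-k))
                           (trans row-l (sym row-k)) col≥col)

    along-free-col : ∀ {c k l} → ¬ Hit (colLine c) → col k ≡ c → col l ≡ c → Reach (Grid n m) (∁ X) k l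
    along-free-col {k = k} {l} free col-k col-l with ≤-total (row k) (row l)
    ... | inj₁ row≤row =
      ColWalk.reach-along (λ _ col-x _ → off-free-line {colLine _} free (trans col-x col-l))
                          (trans col-k (sym col-l)) row≤row
    ... | inj₂ row≥row = reach-sym ~-sym
      (ColWalk.reach-along (λ _ col-x _ → off-free-line {colLine _} free (trans col-x col-k))
                           (trans col-l (sym col-k)) row≥row)

    to-hub : ∀ {r₀ c₀} (r₀<n : r₀ < n) (c₀<m : c₀ < m) → ¬ Hit (rowLine r₀) → ¬ Hit (colLine c₀) →
             ∀ {p} → Good p → Reach (Grid n m) (∁ X) p (vertex r₀<n c₀<m)
    to-hub r₀<n c₀<m free-r₀ free-c₀ {p} (inj₁ free-row-p) =
      reach-trans (along-free-row free-row-p refl (row-vertex (row<n p) c₀<m))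
                  (along-free-col free-c₀ (col-vertex (row<n p) c₀<m) (col-vertex r₀<n c₀<m))
    to-hub r₀<n c₀<m free-r₀ free-c₀ {p} (inj₂ free-col-p) =
      reach-trans (along-free-col free-col-p refl (col-vertex r₀<n (col<m p)))
                  (along-free-row free-r₀ (row-vertex r₀<n (col<m p)) (row-vertex r₀<n c₀<m))

    connected : ∣ X ∣ < n → ∣ X ∣ < m → (∀ {u} → u ∉ X → ReachesGood u) → Connected (∁ X)
    connected ∣X∣<n ∣X∣<m reaches-good u∈ v∈
      with free-line rowLine rows-separate n ∣X∣<n | free-line colLine cols-separate m ∣X∣<m
         | reaches-good (x∈∁p⇒x∉p u∈) | reaches-good (x∈∁p⇒x∉p v∈)
    ... | r₀ , r₀<n , free-r₀ | c₀ , c₀<m , free-c₀ | u′ , good-u′ , u⇝u′ | v′ , good-v′ , v⇝v′ =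
      reach-trans u⇝u′ (reach-trans (hub good-u′) (reach-sym ~-sym (reach-trans v⇝v′ (hub good-v′))))
      where
      hub : ∀ {p} → Good p → Reach (Grid n m) (∁ X) p (vertex r₀<n c₀<m)
      hub = to-hub r₀<n c₀<m free-r₀ free-c₀

    extend : ∀ {u t} → u ∉ X → u ~ t → ReachesGood t → ReachesGood u
    extend u∉X u~t (w , good , t⇝w) = w , good , step (x∉p⇒x∈∁p u∉X) u~t t⇝w

    reaches-good₀ : ∣ X ∣ ≤ 1 → ∀ {u} → u ∉ X → ReachesGood u
    reaches-good₀ ∣X∣≤1 {u} u∉X with good? u
    ... | inj₁ good     = u , good , here (x∉p⇒x∈∁p u∉X)
    ... | inj₂ (hr , hc) = ⊥-elim (≤⇒≯ ∣X∣≤1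
      (lines-bound (rowLine (row u) ∷ colLine (col u) ∷ []) (hr ∷ hc ∷ [])
                   ((crossing-separate u∉X refl refl ∷ []) ∷ [] ∷ [])))

    reaches-good₁ : ∣ X ∣ ≤ 2 → MinDegGE (Grid n m) (∁ X) 1 → ∀ {u} → u ∉ X → ReachesGood u
    reaches-good₁ ∣X∣≤2 δ {u} u∉X with good? u
    ... | inj₁ good      = u , good , here (x∉p⇒x∈∁p u∉X)
    ... | inj₂ (hr , hc) with some-neighbour (δ u (x∉p⇒x∈∁p u∉X))
    ... | t , t∈ , u~t with good? t
    ... | inj₁ good        = t , good , reach-edge (x∉p⇒x∈∁p u∉X) t∈ u~t
    ... | inj₂ (hr′ , hc′) = ⊥-elim (≤⇒≯ ∣X∣≤2 (three-lines (~⇒neighbour u~t)))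
      where
      t∉X : t ∉ X
      t∉X = x∈∁p⇒x∉p t∈
      three-lines : Neighbour u t → 3 ≤ ∣ X ∣
      three-lines (horizontal row≡ s) =
        lines-bound (rowLine (row u) ∷ colLine (col u) ∷ colLine (col t) ∷ []) (hr ∷ hc ∷ hc′ ∷ [])
          ((crossing-separate u∉X refl refl ∷ crossing-separate t∉X row≡ refl ∷ []) ∷
           (cols-separate (step⇒≢ s) ∷ []) ∷ [] ∷ [])
      three-lines (vertical col≡ s) =
        lines-bound (rowLine (row u) ∷ rowLine (row t) ∷ colLine (col u) ∷ []) (hr ∷ hr′ ∷ hc ∷ [])
          ((rows-separate (step⇒≢ s) ∷ crossing-separate u∉X refl refl ∷ []) ∷
           (crossing-separate t∉X refl col≡ ∷ []) ∷ [] ∷ [])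

    bad-row-of-three : ∀ {u w s} → u ∉ X → w ∉ X → s ∉ X → Bad u → Bad w → Bad s →
                       row w ≡ row u → row s ≡ row u → col u ≢ col w → col u ≢ col s → col w ≢ col s →
                       4 ≤ ∣ X ∣
    bad-row-of-three {u} {w} {s} u∉X w∉X s∉X (hr , hc) (_ , hc′) (_ , hc″) row-w row-s u≢w u≢s w≢s =
      lines-bound (rowLine (row u) ∷ colLine (col u) ∷ colLine (col w) ∷ colLine (col s) ∷ [])
        (hr ∷ hc ∷ hc′ ∷ hc″ ∷ [])
        ((crossing-separate u∉X refl refl ∷ crossing-separate w∉X row-w refl ∷
          crossing-separate s∉X row-s refl ∷ []) ∷
         (cols-separate u≢w ∷ cols-separate u≢s ∷ []) ∷ (cols-separate w≢s ∷ []) ∷ [] ∷ [])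

    bad-rectangle : ∀ {u w d s} → u ∉ X → w ∉ X → d ∉ X → s ∉ X → Bad u → Bad s →
                    row w ≡ row u → col w ≡ col s → row d ≡ row s → col d ≡ col u →
                    row u ≢ row s → col u ≢ col s → 4 ≤ ∣ X ∣
    bad-rectangle {u} {s = s} u∉X w∉X d∉X s∉X (hr , hc) (hr′ , hc′) row-w col-w row-d col-d rows≢ cols≢ =
      lines-bound (rowLine (row u) ∷ rowLine (row s) ∷ colLine (col u) ∷ colLine (col s) ∷ [])
        (hr ∷ hr′ ∷ hc ∷ hc′ ∷ [])
        ((rows-separate rows≢ ∷ crossing-separate u∉X refl refl ∷ crossing-separate w∉X row-w col-w ∷ []) ∷
         (crossing-separate d∉X row-d col-d ∷ crossing-separate s∉X refl refl ∷ []) ∷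
         (cols-separate cols≢ ∷ []) ∷ [] ∷ [])

    -- Induction on the row-major index.  A bad vertex u with a neighbour outside X above it or to
    -- its left recurses there.  Otherwise its two neighbours outside X are w to its right and d
    -- below it, and w's second one s lies above w (recurse), right of w (a bad row of three) or
    -- below w (a square u w d s with u, s bad); the last two need four vertices of X.
    reaches-good₂ : ∣ X ∣ ≤ 3 → MinDegGE (Grid n m) (∁ X) 2 → ∀ {u} → u ∉ X → ReachesGood u
    reaches-good₂ ∣X∣≤3 δ {u} =
      WF.All.wfRec (On.wellFounded index <-wellFounded) 0ℓ (λ u → u ∉ X → ReachesGood u) body u
      where
      body : ∀ u → (∀ {v} → index v < index u → v ∉ X → ReachesGood v) → u ∉ X → ReachesGood u
      body u ih u∉X with good? u
      ... | inj₁ good = u , good , here (x∉p⇒x∈∁p u∉X)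
      ... | inj₂ bad-u with some-neighbour (δ u (x∉p⇒x∈∁p u∉X))
      ... | t₁ , t₁∈ , u~t₁ with neighbour-other-than (δ u (x∉p⇒x∈∁p u∉X)) t₁
      ... | t₂ , t₂∈ , u~t₂ , t₂≢t₁ = two-neighbours (~⇒neighbour u~t₁) (~⇒neighbour u~t₂)
        where
        u∈ : u ∈ ∁ X
        u∈ = x∉p⇒x∈∁p u∉X

        earlier : ∀ {t} → t ∈ ∁ X → u ~ t → index t < index u → ReachesGood u
        earlier t∈ u~t t<u = extend u∉X u~t (ih t<u (x∈∁p⇒x∉p t∈))

        through : ∀ {w s} → w ∈ ∁ X → s ∈ ∁ X → u ~ w → w ~ s → (Bad s → 4 ≤ ∣ X ∣) → ReachesGood u
        through {s = s} w∈ s∈ u~w w~s bad⇒4≤∣X∣ with good? s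
        ... | inj₁ good  = _ , good , step u∈ u~w (reach-edge w∈ s∈ w~s)
        ... | inj₂ bad-s = ⊥-elim (≤⇒≯ ∣X∣≤3 (bad⇒4≤∣X∣ bad-s))

        right-and-below : ∀ {w d} → w ∈ ∁ X → d ∈ ∁ X → u ~ w → row w ≡ row u → suc (col u) ≡ col w →
                          col d ≡ col u → suc (row u) ≡ row d → ReachesGood u
        right-and-below {w} {d} w∈ d∈ u~w row-w col-w col-d row-d with good? w
        ... | inj₁ good = w , good , reach-edge u∈ w∈ u~w
        ... | inj₂ bad-w with neighbour-other-than (δ w w∈) u
        ... | s , s∈ , w~s , s≢u with ~⇒neighbour w~s
        ... | horizontal row-s (back col-s) =
          ⊥-elim (s≢u (coords-injective (trans row-s row-w) (suc-injective (trans col-s (sym col-w)))))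
        ... | vertical _ (back row-s) =
          extend u∉X u~w (extend (x∈∁p⇒x∉p w∈) w~s
            (ih (index-above (≤-reflexive (trans row-s row-w))) (x∈∁p⇒x∉p s∈)))
        ... | horizontal row-s (forth col-s) =
          through w∈ s∈ u~w w~s λ bad-s →
            bad-row-of-three u∉X (x∈∁p⇒x∉p w∈) (x∈∁p⇒x∉p s∈) bad-u bad-w bad-s row-w (trans row-s row-w)
              (step⇒≢ (forth col-w)) (<⇒≢ (<-trans (≤-reflexive col-w) (≤-reflexive col-s)))
              (step⇒≢ (forth col-s))
        ... | vertical col-s (forth row-s) =
          through w∈ s∈ u~w w~s λ bad-s →
            bad-rectangle u∉X (x∈∁p⇒x∉p w∈) (x∈∁p⇒x∉p d∈) (x∈∁p⇒x∉p s∈) bad-u bad-s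
              row-w (sym col-s) (trans (sym row-d) u↓s) col-d
              (step⇒≢ (forth u↓s)) (step⇒≢ (forth (trans col-w (sym col-s))))
          where
          u↓s : suc (row u) ≡ row s
          u↓s = trans (cong suc (sym row-w)) row-s

        two-neighbours : Neighbour u t₁ → Neighbour u t₂ → ReachesGood u
        two-neighbours (horizontal row-t (back col-t)) _ =
          earlier t₁∈ u~t₁ (index-left row-t (≤-reflexive col-t))
        two-neighbours (vertical _ (back row-t))       _ = earlier t₁∈ u~t₁ (index-above (≤-reflexive row-t))
        two-neighbours _ (horizontal row-t (back col-t)) =
          earlier t₂∈ u~t₂ (index-left row-t (≤-reflexive col-t))
        two-neighbours _ (vertical _ (back row-t))       = earlier t₂∈ u~t₂ (index-above (≤-reflexive row-t))
        two-neighbours (horizontal row₁ (forth col₁)) (horizontal row₂ (forth col₂)) =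
          ⊥-elim (t₂≢t₁ (coords-injective (trans row₂ (sym row₁)) (trans (sym col₂) col₁)))
        two-neighbours (vertical col₁ (forth row₁)) (vertical col₂ (forth row₂)) =
          ⊥-elim (t₂≢t₁ (coords-injective (trans (sym row₂) row₁) (trans col₂ (sym col₁))))
        two-neighbours (horizontal row₁ (forth col₁)) (vertical col₂ (forth row₂)) =
          right-and-below t₁∈ t₂∈ u~t₁ row₁ col₁ col₂ row₂
        two-neighbours (vertical col₁ (forth row₁)) (horizontal row₂ (forth col₂)) =
          right-and-below t₂∈ t₁∈ u~t₂ row₂ col₂ col₁ row₁

    reaches-good : ∀ {g} → g ≤ 2 → ∣ X ∣ ≤ suc g → MinDegGE (Grid n m) (∁ X) g → ∀ {u} → u ∉ X → ReachesGood u
    reaches-good {zero}              _ ∣X∣≤1 _ = reaches-good₀ ∣X∣≤1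
    reaches-good {suc zero}          _          = reaches-good₁
    reaches-good {suc (suc zero)}    _          = reaches-good₂
    reaches-good {suc (suc (suc _))} (s≤s (s≤s ()))

  small-cut-connected : ∀ {g} → g ≤ 2 → 4 ≤ n → 4 ≤ m →
                        ∀ {X} → ∣ X ∣ ≤ suc g → MinDegGE (Grid n m) (∁ X) g → Connected (∁ X)
  small-cut-connected g≤2 4≤n 4≤m {X} ∣X∣≤g+1 δ =
    connected (below 4≤n) (below 4≤m) (reaches-good g≤2 ∣X∣≤g+1 δ)
    where
    open SmallCut X
    below : ∀ {k} → 4 ≤ k → ∣ X ∣ < k
    below 4≤k = ≤-trans (s≤s ∣X∣≤g+1) (≤-trans (s≤s (s≤s g≤2)) 4≤k)

  -- The corner cuts

  corner? : ∀ r s k → Dec (InCorner r s (row k) (col k))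
  corner? r s k = inCorner? r s (row k) (col k)

  frame? : ∀ r s k → Dec (InFrame r s (row k) (col k))
  frame? r s k = inFrame? r s (row k) (col k)

  corner frame : ℕ → ℕ → Subset (n * m)
  corner r s = select (corner? r s)
  frame  r s = select (frame? r s)

  coords : V → ℕ × ℕ
  coords k = row k , col k

  ∣p∣≤length-of-coords-cover : ∀ p cells → (∀ {k} → k ∈ p → coords k List.∈ cells) → ∣ p ∣ ≤ length cells
  ∣p∣≤length-of-coords-cover = ∣p∣≤length-of-cover (≡-dec _≟_ _≟_) coords
    (λ coords≡ → coords-injective (cong proj₁ coords≡) (cong proj₂ coords≡))

  ∣corner∣≤ : ∀ r s → ∣ corner r s ∣ ≤ r * s
  ∣corner∣≤ r s = subst (∣ corner r s ∣ ≤_)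
    (trans (length-cartesianProduct (upTo r) (upTo s)) (cong₂ _*_ (length-upTo r) (length-upTo s)))
    (∣p∣≤length-of-coords-cover (corner r s) _
      (λ k∈ → let (row<r , col<s) = ∈-select⁻ (corner? r s) k∈
              in ∈-cartesianProduct⁺ (∈-upTo⁺ row<r) (∈-upTo⁺ col<s)))

  ∣frame∣≤ : ∀ r s → ∣ frame r s ∣ ≤ s + r
  ∣frame∣≤ r s = subst (∣ frame r s ∣ ≤_)
    (trans (length-++ (map (r ,_) (upTo s)))
           (cong₂ _+_ (trans (length-map (r ,_) (upTo s)) (length-upTo s))
                      (trans (length-map (_, s) (upTo r)) (length-upTo r))))
    (∣p∣≤length-of-coords-cover (frame r s) _ covered)
    where
    covered : ∀ {k} → k ∈ frame r s → coords k List.∈ map (r ,_) (upTo s) ++ map (_, s) (upTo r)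
    covered k∈ with ∈-select⁻ (frame? r s) k∈
    ... | inj₁ (refl , col<s) = ∈-++⁺ˡ (∈-map⁺ (_ ,_) (∈-upTo⁺ col<s))
    ... | inj₂ (row<r , refl) = ∈-++⁺ʳ _ (∈-map⁺ (_, _) (∈-upTo⁺ row<r))

  corner⊆∁frame : ∀ {r s} → corner r s ⊆ ∁ (frame r s)
  corner⊆∁frame {r} {s} k∈ =
    x∉p⇒x∈∁p (λ k∈frame → inCorner⇒¬inFrame (∈-select⁻ (corner? r s) k∈) (∈-select⁻ (frame? r s) k∈frame))

  corner-closed-under-~ : ∀ {r s} i j → i ∈ corner r s → j ∉ frame r s → i ~ j → j ∈ corner r s
  corner-closed-under-~ {r} {s} i j i∈ j∉ i~j with ∈-select⁻ (corner? r s) i∈ | ~⇒neighbour i~j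
  ... | row<r , col<s | horizontal row≡ col-step =
    ∈-select⁺ (corner? r s) (subst (λ a → InCorner r s a (col j)) (sym row≡)
      (swap (corner-closed (col<s , row<r) col-step
               (λ frame′ → j∉ (∈-select⁺ (frame? r s) (subst (λ a → InFrame r s a (col j)) (sym row≡)
                                                               (frame-transpose frame′)))))))
  ... | row<r , col<s | vertical col≡ row-step =
    ∈-select⁺ (corner? r s) (subst (InCorner r s (row j)) (sym col≡)
      (corner-closed (row<r , col<s) row-step
        (λ frame′ → j∉ (∈-select⁺ (frame? r s) (subst (InFrame r s (row j)) (sym col≡) frame′)))))

  module Corner {r s : ℕ} (0<r : 0 < r) (0<s : 0 < s) (r<n : r < n) (s<m : s < m) where

    0<n : 0 < n
    0<n = <-trans 0<r r<n

    0<m : 0 < m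
    0<m = <-trans 0<s s<m

    origin far : V
    origin = vertex 0<n 0<m
    far    = vertex r<n s<m

    origin∈corner : origin ∈ corner r s
    origin∈corner = ∈-select⁺ (corner? r s)
      (subst₂ (InCorner r s) (sym (row-vertex 0<n 0<m)) (sym (col-vertex 0<n 0<m)) (0<r , 0<s))

    far∉corner : far ∉ corner r s
    far∉corner far∈ with ∈-select⁻ (corner? r s) far∈
    ... | r′<r , _ = <-irrefl (row-vertex r<n s<m) r′<r

    far∉frame : far ∉ frame r s
    far∉frame far∈ with ∈-select⁻ (frame? r s) far∈
    ... | inj₁ (_ , s′<s) = <-irrefl (col-vertex r<n s<m) s′<s
    ... | inj₂ (r′<r , _) = <-irrefl (row-vertex r<n s<m) r′<r

    from-origin : ∀ {k} → k ∈ corner r s → Reach (Grid n m) (corner r s) origin k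
    from-origin {k} k∈ with ∈-select⁻ (corner? r s) k∈
    ... | row<r , col<s = reach-trans down-first-column along-row
      where
      k₀ : V
      k₀ = vertex (row<n k) 0<m
      down-first-column : Reach (Grid n m) (corner r s) origin k₀
      down-first-column = ColWalk.reach-along
        (λ x col-x row-x → ∈-select⁺ (corner? r s)
           (≤-<-trans row-x (subst (_< r) (sym (row-vertex (row<n k) 0<m)) row<r) ,
            subst (_< s) (sym (trans col-x (col-vertex (row<n k) 0<m))) 0<s))
        (trans (col-vertex 0<n 0<m) (sym (col-vertex (row<n k) 0<m)))
        (subst (_≤ row k₀) (sym (row-vertex 0<n 0<m)) z≤n)
      along-row : Reach (Grid n m) (corner r s) k₀ k
      along-row = RowWalk.reach-along
        (λ x row-x col-x → ∈-select⁺ (corner? r s) (subst (_< r) (sym row-x) row<r , ≤-<-trans col-x col<s))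
        (row-vertex (row<n k) 0<m)
        (subst (_≤ col k) (sym (col-vertex (row<n k) 0<m)) z≤n)

    component : Component (Grid n m) (frame r s) (corner r s)
    component =
      corner⊆∁frame , (origin , origin∈corner) ,
      (λ i j i∈ j∈ → reach-trans (reach-sym ~-sym (from-origin i∈)) (from-origin j∈)) ,
      corner-closed-under-~

    disconnected : Disconnected (Grid n m) (frame r s)
    disconnected =
      origin , far , x∈∁p⇒x∉p (corner⊆∁frame origin∈corner) , far∉frame ,
      λ origin⇝far → far∉corner (closed-reach corner-closed-under-~ origin⇝far origin∈corner)

  vertical-step-off-frame : ∀ {r s k} → 2 ≤ r → 3 + r ≤ n → k ∉ frame r s →
                            ∃ λ l → l ∉ frame r s × k ~ l × col l ≡ col k
  vertical-step-off-frame {r} {s} {k} 2≤r 3+r≤n k∉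
    with frame-avoiding-step 2≤r 3+r≤n (row<n k) (λ k-in → k∉ (∈-select⁺ (frame? r s) k-in))
  ... | a′ , a′<n , row-step , ¬l-in = l , l∉ , k~l , col-vertex a′<n (col<m k)
    where
    l : V
    l = vertex a′<n (col<m k)
    l∉ : l ∉ frame r s
    l∉ l∈ = ¬l-in (subst₂ (InFrame r s) (row-vertex a′<n (col<m k)) (col-vertex a′<n (col<m k))
                          (∈-select⁻ (frame? r s) l∈))
    k~l : k ~ l
    k~l = neighbour⇒~ (vertical (col-vertex a′<n (col<m k))
                                (subst (Step (row k)) (sym (row-vertex a′<n (col<m k))) row-step))

  horizontal-step-off-frame : ∀ {r s k} → 2 ≤ s → 3 + s ≤ m → k ∉ frame r s →
                              ∃ λ l → l ∉ frame r s × k ~ l × row l ≡ row k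
  horizontal-step-off-frame {r} {s} {k} 2≤s 3+s≤m k∉
    with frame-avoiding-step 2≤s 3+s≤m (col<m k) (λ k-in → k∉ (∈-select⁺ (frame? r s) (frame-transpose k-in)))
  ... | b′ , b′<m , col-step , ¬l-in = l , l∉ , k~l , row-vertex (row<n k) b′<m
    where
    l : V
    l = vertex (row<n k) b′<m
    l∉ : l ∉ frame r s
    l∉ l∈ = ¬l-in (frame-transpose (subst₂ (InFrame r s) (row-vertex (row<n k) b′<m) (col-vertex (row<n k) b′<m)
                                           (∈-select⁻ (frame? r s) l∈)))
    k~l : k ~ l
    k~l = neighbour⇒~ (horizontal (row-vertex (row<n k) b′<m)
                                  (subst (Step (col k)) (sym (col-vertex (row<n k) b′<m)) col-step))

  frame-minDeg₁ : ∀ {r s} → 2 ≤ s → 3 + s ≤ m → MinDegGE (Grid n m) (∁ (frame r s)) 1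
  frame-minDeg₁ 2≤s 3+s≤m k k∈ with horizontal-step-off-frame 2≤s 3+s≤m (x∈∁p⇒x∉p k∈)
  ... | l , l∉ , k~l , _ = hasNbrs₁ (x∉p⇒x∈∁p l∉) k~l

  frame-minDeg₂ : ∀ {r s} → 2 ≤ r → 2 ≤ s → 3 + r ≤ n → 3 + s ≤ m → MinDegGE (Grid n m) (∁ (frame r s)) 2
  frame-minDeg₂ 2≤r 2≤s 3+r≤n 3+s≤m k k∈
    with vertical-step-off-frame 2≤r 3+r≤n (x∈∁p⇒x∉p k∈) | horizontal-step-off-frame 2≤s 3+s≤m (x∈∁p⇒x∉p k∈)
  ... | l₁ , l₁∉ , k~l₁ , col₁ | l₂ , l₂∉ , k~l₂ , row₂ =
    hasNbrs₂ (x∉p⇒x∈∁p l₁∉) (x∉p⇒x∈∁p l₂∉) l₁≢l₂ k~l₁ k~l₂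
    where
    l₁≢l₂ : l₁ ≢ l₂
    l₁≢l₂ refl = ~⇒≢ k~l₁ (coords-injective (sym row₂) (sym col₁))

  corner-attains : 5 ≤ n → 5 ≤ m → ∀ {g} r s .{{_ : NonZero r}} .{{_ : NonZero s}} →
                   g ≤ 2 → suc (suc g) ≡ s + r → MinDegGE (Grid n m) (∁ (frame r s)) g → MinOrder g (r * s) →
                   GCNumberIs (Grid n m) g (s + r + r * s)
  corner-attains 5≤n 5≤m {g} r s g≤2 g+2≡s+r δ order =
    gcNumberIs-attained lower (disconnected , δ) component
      (small⇒¬splittable {C = corner r s} order
         (≤-<-trans (∣corner∣≤ r s) (m<m+n (r * s) (*-mono-≤ (>-nonZero⁻¹ r) (>-nonZero⁻¹ s)))))
      (+-mono-≤ (∣frame∣≤ r s) (∣corner∣≤ r s))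
    where
    g+3≤5 : suc (s + r) ≤ 5
    g+3≤5 = ≤-trans (≤-reflexive (cong suc (sym g+2≡s+r))) (s≤s (s≤s (s≤s g≤2)))
    open Corner (>-nonZero⁻¹ r) (>-nonZero⁻¹ s)
                (≤-trans (s≤s (m≤n+m r s)) (≤-trans g+3≤5 5≤n))
                (≤-trans (s≤s (m≤m+n s r)) (≤-trans g+3≤5 5≤m))
    lower : ∀ X C t → GoodNeighborCut (Grid n m) g X → CompValue (Grid n m) g X C t →
            s + r + r * s ≤ ∣ X ∣ + t
    lower X C t cut value = subst (_≤ ∣ X ∣ + t) (cong (_+ r * s) g+2≡s+r)
      (gcNumber-≥ (small-cut-connected g≤2 (≤-trans (n≤1+n 4) 5≤n) (≤-trans (n≤1+n 4) 5≤m))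
                  order X C t cut value)

proposition6p1 : (n m : ℕ) → 5 ≤ m → m ≤ n →
    GCNumberIs (Grid n m) 0 3 × GCNumberIs (Grid n m) 1 5 × GCNumberIs (Grid n m) 2 8
proposition6p1 n m 5≤m m≤n =
    corner-attains 5≤n 5≤m 1 1 z≤n refl (λ _ _ → hasNbrs₀) minOrder₀ ,
    corner-attains 5≤n 5≤m 1 2 (s≤s z≤n) refl (frame-minDeg₁ ≤-refl 5≤m) (minOrder₁ ~⇒≢) ,
    corner-attains 5≤n 5≤m 2 2 ≤-refl refl (frame-minDeg₂ ≤-refl ≤-refl 5≤n 5≤m) (minOrder₂ ~⇒≢ triangle-free)
  where
  open GridGraph n m
  5≤n : 5 ≤ n
  5≤n = ≤-trans 5≤m m≤n
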